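{- Let $\pi$ be a simple permutation of length $n\ge 4$ avoiding both $2143$ and $4231$. Let $\ell=(1,\pi(1))$, $r=(n,\pi(n))$, let $u=(p_u,n)$ be the highest point and $d=(p_d,1)$ the lowest point. Suppose these four points form the pattern $3142$, i.e. $1<p_d<p_u<n$ and $1<\pi(n)<\pi(1)<n$. Define the regions (sets of points $(i,\pi(i))$): $A$: $1<i<p_d$, $\pi(1)<\pi(i)<n$; $B$: $p_d<i<p_u$, $\pi(1)<\pi(i)<n$; $C$: $1<i<p_d$, $\pi(n)<\pi(i)<\pi(1)$; $D$: $p_d<i<p_u$, $\pi(n)<\pi(i)<\pi(1)$; $E$: $p_u<i<n$, $\pi(n)<\pi(i)<\pi(1)$; $F$: $p_d<i<p_u$, $1<\pi(i)<\pi(n)$; $G$: $p_u<i<n$, $1<\pi(i)<\pi(n)$. Then every point of $\pi$ other than $\ell,r,u,d$ lies in $A\cup B\cup D\cup F\cup G$ (in particular $C$ and $E$ are empty, as are the regions $1<i<p_d,\ 1<\pi(i)<\pi(n)$ and $p_u<i<n,\ \pi(1)<\pi(i)<n$); the points of $B\cup\{u\}$ form an increasing sequence; the points of $D$ form a decreasing sequence; the points of $F\cup\{d\}$ form an increasing sequence; $A$ contains at most one point, and if it contains a point its value lies strictly between the smallest and the second smallest values of $B\cup\{u\}$; $G$ contains at most one point, and if it contains a point its value lies strictly between the second largest and the largest values of $F\cup\{d\}$. The cells $A$ and $G$ may be empty.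
   Context: A permutation of length $n$ is an arrangement $\pi(1)\cdots\pi(n)$ of $1,\dots,n$, viewed as the set of points $(i,\pi(i))$. $\pi$ is contained in $\sigma$ if some subsequence of $\sigma$ is in the same relative order as $\pi$; otherwise $\sigma$ avoids $\pi$. A set of points forms pattern $\tau$ if, read left to right, their values are in the same relative order as $\tau$. An interval is a set of contiguous entries whose values form a set of consecutive integers; trivial if of size $1$ or the whole permutation. A permutation is simple if all its intervals are trivial. -}

module Defs where

open import Data.Nat using (ℕ; zero; suc; _<_; _≤_)
open import Data.Fin using (Fin; toℕ)
import Data.Fin as F
open import Data.Fin.Permutation using (Permutation′; _⟨$⟩ʳ_)
open import Data.Product using (Σ; ∃; _×_; _,_)
open import Data.Sum using (_⊎_)
open import Relation.Binary.PropositionalEquality using (_≡_)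
open import Relation.Nullary using (¬_)
open import Data.Vec using (Vec; lookup; _∷_; [])

P : ∀ {n} → Fin n → ℕ
P i = suc (toℕ i)

V : ∀ {n} → Permutation′ n → Fin n → ℕ
V π i = suc (toℕ (π ⟨$⟩ʳ i))

Contains : ∀ {k n} → (Fin k → ℕ) → (Fin n → ℕ) → Set
Contains {k} {n} τ σ =
  Σ (Fin k → Fin n) λ f →
    (∀ i j → i F.< j → f i F.< f j) ×
    (∀ i j → (τ i < τ j → σ (f i) < σ (f j)) × (σ (f i) < σ (f j) → τ i < τ j))

Avoids : ∀ {k n} → (Fin k → ℕ) → Permutation′ n → Set
Avoids τ π = ¬ Contains τ (V π)

pat2143 : Fin 4 → ℕ
pat2143 i = lookup (2 ∷ 1 ∷ 4 ∷ 3 ∷ []) i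

pat4231 : Fin 4 → ℕ
pat4231 i = lookup (4 ∷ 2 ∷ 3 ∷ 1 ∷ []) i

IsInterval : ∀ {n} → Permutation′ n → Fin n → Fin n → Set
IsInterval π a b =
  (a F.≤ b) ×
  (∀ i j (v : ℕ) → a F.≤ i → i F.≤ b → a F.≤ j → j F.≤ b →
     V π i ≤ v → v ≤ V π j →
     ∃ λ k → (a F.≤ k) × (k F.≤ b) × (V π k ≡ v))

TrivialInterval : ∀ {n} → Fin n → Fin n → Set
TrivialInterval {n} a b = (a ≡ b) ⊎ ((toℕ a ≡ 0) × (P b ≡ n))

Simple : ∀ {n} → Permutation′ n → Set
Simple π = ∀ a b → IsInterval π a b → TrivialInterval a b

InBox : ∀ {n} → Permutation′ n → ℕ → ℕ → ℕ → ℕ → Fin n → Set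
InBox π x₁ x₂ y₁ y₂ i = (x₁ < P i) × (P i < x₂) × (y₁ < V π i) × (V π i < y₂)

Increasing : ∀ {n} → Permutation′ n → (Fin n → Set) → Set
Increasing π S = ∀ i j → S i → S j → P i < P j → V π i < V π j

Decreasing : ∀ {n} → Permutation′ n → (Fin n → Set) → Set
Decreasing π S = ∀ i j → S i → S j → P i < P j → V π j < V π i

AtMostOne : ∀ {n} → (Fin n → Set) → Set
AtMostOne S = ∀ i j → S i → S j → i ≡ j

SmallestTwo : ∀ {n} → Permutation′ n → (Fin n → Set) → Fin n → Fin n → Set
SmallestTwo π S s₁ s₂ =
  S s₁ × S s₂ × ¬ (s₁ ≡ s₂) ×
  (∀ c → S c → V π s₁ ≤ V π c) ×
  (∀ c → S c → ¬ (c ≡ s₁) → V π s₂ ≤ V π c)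

LargestTwo : ∀ {n} → Permutation′ n → (Fin n → Set) → Fin n → Fin n → Set
LargestTwo π S s₁ s₂ =
  S s₁ × S s₂ × ¬ (s₁ ≡ s₂) ×
  (∀ c → S c → V π c ≤ V π s₁) ×
  (∀ c → S c → ¬ (c ≡ s₁) → V π c ≤ V π s₂)

-- The corner left of d below r and the corner right of u above l are excluded by a 2143 through
-- d, u, r (resp. l, d, u). Every other exclusion rests on one observation: a set of points at
-- consecutive positions that contains every point whose value lies between two of its values is
-- an interval, so in a simple permutation it is a single point or everything. A point of C (of E)
-- makes the prefix ending at it (the suffix starting at it) such a set; a point of A below the
-- lowest point s₁ of B ∪ {u} does the same for the prefix ending at the last point left of d
-- below s₁, and dually for G; and A and G are themselves such sets, so each has at most one
-- point. The monotonicity claims and the remaining bounds on A and G are single occurrences of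
-- 2143 or 4231.

module Submission where

open import Defs
open import Data.Nat using (ℕ; zero; suc; _<_; _≤_; _∸_; z≤n; s≤s)
open import Data.Nat.Properties
open import Data.Nat.Induction using (<-rec)
open import Data.Fin using (Fin; toℕ; fromℕ<; inject₁)
import Data.Fin as F
import Data.Fin.Properties as Finₚ
open import Data.Fin.Patterns
open import Data.Fin.Permutation using (Permutation′; _⟨$⟩ʳ_; _⟨$⟩ˡ_; inverseˡ; inverseʳ)
open import Data.Product using (∃; ∃₂; _×_; _,_; proj₁; proj₂)
open import Data.Sum using (_⊎_; inj₁; inj₂; [_,_])
open import Data.Empty using (⊥; ⊥-elim)
open import Data.Vec using (lookup; _∷_; [])
open import Function using (_∘_)
open import Relation.Binary using (_Preserves_⟶_; tri<; tri≈; tri>)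
open import Relation.Binary.PropositionalEquality
  using (_≡_; _≢_; refl; sym; trans; cong; subst; ≢-sym; module ≡-Reasoning)
open import Relation.Nullary using (¬_; yes; no)
open import Relation.Nullary.Decidable using (_×-dec_; _⊎-dec_; ¬?)
open import Relation.Unary using (Decidable)

ascending : ∀ {k} (w : Fin (suc k) → ℕ) → (∀ i → w (inject₁ i) < w (F.suc i)) →
            w Preserves F._<_ ⟶ _<_
ascending {zero}  w step {0F} {0F} ()
ascending {suc k} w step {0F} {1F} _ = step 0F
ascending {suc k} w step {0F} {F.suc (F.suc j)} _ =
  <-trans (step 0F) (ascending (w ∘ F.suc) (step ∘ F.suc) {0F} {F.suc j} (s≤s z≤n))
ascending {suc k} w step {F.suc i} {F.suc j} (s≤s i<j) = ascending (w ∘ F.suc) (step ∘ F.suc) i<j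

reflects-< : ∀ {k} {w : Fin k → ℕ} → w Preserves F._<_ ⟶ _<_ → ∀ {i j} → w i < w j → i F.< j
reflects-< mono {i} {j} wi<wj with Finₚ.<-cmp i j
... | tri< i<j _ _ = i<j
... | tri≈ _ refl _ = ⊥-elim (<-irrefl refl wi<wj)
... | tri> _ _ j<i = ⊥-elim (<-asym wi<wj (mono j<i))

-- g lists points by increasing σ-value and h i is the rank of the i-th entry of τ; if the points
-- g (h 0), g (h 1), … are in left-to-right order they form an occurrence of τ.
contains-by-rank : ∀ {k n} (τ : Fin (suc k) → ℕ) (σ : Fin n → ℕ) (h : Fin (suc k) → Fin (suc k))
  (g : Fin (suc k) → Fin n) → (∀ i → τ i ≡ P (h i)) →
  (∀ i → P (g (h (inject₁ i))) < P (g (h (F.suc i)))) → (∀ i → σ (g (inject₁ i)) < σ (g (F.suc i))) →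
  Contains τ σ
contains-by-rank τ σ h g τ≡rank position-steps value-steps =
  g ∘ h , (λ i j i<j → ≤-pred (positions i<j)) , λ i j → forth i j , back i j
  where
  positions : (P ∘ g ∘ h) Preserves F._<_ ⟶ _<_
  positions = ascending (P ∘ g ∘ h) position-steps
  values : (σ ∘ g) Preserves F._<_ ⟶ _<_
  values = ascending (σ ∘ g) value-steps
  forth : ∀ i j → τ i < τ j → σ (g (h i)) < σ (g (h j))
  forth i j τi<τj rewrite τ≡rank i | τ≡rank j = values (≤-pred τi<τj)
  back : ∀ i j → σ (g (h i)) < σ (g (h j)) → τ i < τ j
  back i j σi<σj rewrite τ≡rank i | τ≡rank j = s≤s (reflects-< values σi<σj)

P≤n : ∀ {n} (i : Fin n) → P i ≤ n
P≤n = Finₚ.toℕ<n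

P-injective : ∀ {n} {i j : Fin n} → P i ≡ P j → i ≡ j
P-injective = Finₚ.toℕ-injective ∘ suc-injective

P<⇒≢ : ∀ {n} {i j : Fin n} → P i < P j → i ≢ j
P<⇒≢ i<j refl = <-irrefl refl i<j

P≤∧≢⇒< : ∀ {n} {i j : Fin n} → P i ≤ P j → i ≢ j → P i < P j
P≤∧≢⇒< i≤j i≢j = ≤∧≢⇒< i≤j (i≢j ∘ P-injective)

record Least {n} (Q : Fin n → Set) (f : Fin n → ℕ) : Set where
  field
    point : Fin n
    holds : Q point
    ≤-all : ∀ y → Q y → f point ≤ f y

record Greatest {n} (Q : Fin n → Set) (f : Fin n → ℕ) : Set where
  field
    point : Fin n
    holds : Q point
    all-≤ : ∀ y → Q y → f y ≤ f point

module _ {n} {Q : Fin n → Set} (Q? : Decidable Q) where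

  -- Kept abstract: otherwise the type checker unfolds the search whenever it compares the points.
  abstract
    least : (f : Fin n → ℕ) → ∀ {x} → Q x → Least Q f
    least f {x} Qx = <-rec (λ k → ∀ x → Q x → f x ≡ k → Least Q f) step (f x) x Qx refl
      where
      step : ∀ k → (∀ {j} → j < k → ∀ x → Q x → f x ≡ j → Least Q f) → ∀ x → Q x → f x ≡ k → Least Q f
      step _ smaller x Qx refl with Finₚ.any? (λ y → Q? y ×-dec (f y <? f x))
      ... | yes (y , Qy , fy<fx) = smaller fy<fx y Qy refl
      ... | no none = record
        { point = x ; holds = Qx ; ≤-all = λ y Qy → ≮⇒≥ (λ fy<fx → none (y , Qy , fy<fx)) }

    greatest : (f : Fin n → ℕ) → ∀ {K} → (∀ y → f y ≤ K) → ∀ {x} → Q x → Greatest Q f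
    greatest f {K} f≤K Qx = record { point = point ; holds = holds ; all-≤ = all-≤ }
      where
      open Least (least (λ y → K ∸ f y) Qx)
      all-≤ : ∀ y → Q y → f y ≤ f point
      all-≤ y Qy = ≮⇒≥ λ fp<fy → <⇒≱ (∸-monoʳ-< fp<fy (f≤K y)) (≤-all y Qy)

Within : ∀ {n} → Fin n → Fin n → Fin n → Set
Within a b y = P a ≤ P y × P y ≤ P b

Contiguous : ∀ {n} → (Fin n → Set) → Set
Contiguous S = ∀ {a b y} → S a → S b → P a ≤ P y → P y ≤ P b → S y

ValueClosed : ∀ {n} → Permutation′ n → (Fin n → Set) → Set
ValueClosed π S = ∀ {i j y} → S i → S j → V π i < V π y → V π y < V π j → S y

module _ {n} (π : Permutation′ n) where

  V≤n : ∀ i → V π i ≤ n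
  V≤n i = Finₚ.toℕ<n (π ⟨$⟩ʳ i)

  V-injective : ∀ {i j} → V π i ≡ V π j → i ≡ j
  V-injective {i} {j} Vi≡Vj = begin
    i                     ≡⟨ inverseˡ π ⟨
    π ⟨$⟩ˡ (π ⟨$⟩ʳ i)     ≡⟨ cong (π ⟨$⟩ˡ_) (Finₚ.toℕ-injective (suc-injective Vi≡Vj)) ⟩
    π ⟨$⟩ˡ (π ⟨$⟩ʳ j)     ≡⟨ inverseˡ π ⟩
    j                     ∎
    where open ≡-Reasoning

  V<⇒≢ : ∀ {i j} → V π i < V π j → i ≢ j
  V<⇒≢ i<j refl = <-irrefl refl i<j

  V≤∧≢⇒< : ∀ {i j} → V π i ≤ V π j → i ≢ j → V π i < V π j
  V≤∧≢⇒< i≤j i≢j = ≤∧≢⇒< i≤j (i≢j ∘ V-injective)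

  rising : ∀ {i j} → P i < P j → ¬ V π j < V π i → V π i < V π j
  rising i<j not-falling = V≤∧≢⇒< (≮⇒≥ not-falling) (P<⇒≢ i<j)

  falling : ∀ {i j} → P i < P j → ¬ V π i < V π j → V π j < V π i
  falling i<j not-rising = V≤∧≢⇒< (≮⇒≥ not-rising) (≢-sym (P<⇒≢ i<j))

  preimage : ∀ {w} → 1 ≤ w → w ≤ n → ∃ λ k → V π k ≡ w
  preimage {suc w} _ w<n =
    π ⟨$⟩ˡ fromℕ< w<n , cong suc (trans (cong toℕ (inverseʳ π)) (Finₚ.toℕ-fromℕ< w<n))

  increasing⇒P< : ∀ {S} → Increasing π S → ∀ {i j} → S i → S j → V π i < V π j → P i < P j
  increasing⇒P< increasing {i} {j} Si Sj i<j =
    P≤∧≢⇒< (≮⇒≥ λ Pj<Pi → <-asym (increasing j i Sj Si Pj<Pi) i<j) (V<⇒≢ i<j)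

  no2143 : Avoids pat2143 π → (a b c e : Fin n) → P a < P b → P b < P c → P c < P e →
           V π b < V π a → V π a < V π e → V π e < V π c → ⊥
  no2143 avoid a b c e ab bc ce ba ae ec =
    avoid (contains-by-rank pat2143 (V π) rank (lookup (b ∷ a ∷ e ∷ c ∷ []))
             (λ { 0F → refl ; 1F → refl ; 2F → refl ; 3F → refl })
             (λ { 0F → ab ; 1F → bc ; 2F → ce }) (λ { 0F → ba ; 1F → ae ; 2F → ec }))
    where
    rank : Fin 4 → Fin 4
    rank = lookup (1F ∷ 0F ∷ 3F ∷ 2F ∷ [])

  no4231 : Avoids pat4231 π → (a b c e : Fin n) → P a < P b → P b < P c → P c < P e →
           V π e < V π b → V π b < V π c → V π c < V π a → ⊥
  no4231 avoid a b c e ab bc ce eb bc′ ca =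
    avoid (contains-by-rank pat4231 (V π) rank (lookup (e ∷ b ∷ c ∷ a ∷ []))
             (λ { 0F → refl ; 1F → refl ; 2F → refl ; 3F → refl })
             (λ { 0F → ab ; 1F → bc ; 2F → ce }) (λ { 0F → eb ; 1F → bc′ ; 2F → ca }))
    where
    rank : Fin 4 → Fin 4
    rank = lookup (3F ∷ 1F ∷ 2F ∷ 0F ∷ [])

  value-closed-block⇒interval : ∀ {a b} → P a ≤ P b → ValueClosed π (Within a b) → IsInterval π a b
  value-closed-block⇒interval {a} {b} a≤b closed = ≤-pred a≤b , fill
    where
    fill : ∀ i j w → a F.≤ i → i F.≤ b → a F.≤ j → j F.≤ b → V π i ≤ w → w ≤ V π j →
           ∃ λ k → a F.≤ k × k F.≤ b × V π k ≡ w
    fill i j w ai ib aj jb i≤w w≤j with preimage (≤-trans (s≤s z≤n) i≤w) (≤-trans w≤j (V≤n j))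
    ... | k , refl = k , ≤-pred (proj₁ within) , ≤-pred (proj₂ within) , refl
      where
      within : Within a b k
      within with m≤n⇒m<n∨m≡n i≤w | m≤n⇒m<n∨m≡n w≤j
      ... | inj₂ i≡k | _        = subst (Within a b) (V-injective i≡k) (s≤s ai , s≤s ib)
      ... | inj₁ _   | inj₂ k≡j = subst (Within a b) (V-injective (sym k≡j)) (s≤s aj , s≤s jb)
      ... | inj₁ i<k | inj₁ k<j = closed (s≤s ai , s≤s ib) (s≤s aj , s≤s jb) i<k k<j

  simple⇒atMostOne : ∀ {S} → Simple π → Decidable S → Contiguous S → ValueClosed π S →
                     ∀ w → ¬ S w → AtMostOne S
  simple⇒atMostOne {S} simple S? contiguous closed w ¬Sw i j Si Sj = trivial⇒i≡j (simple a b interval)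
    where
    open Least (least S? P Si) renaming (point to a; holds to Sa; ≤-all to a≤)
    open Greatest (greatest S? P P≤n Si) renaming (point to b; holds to Sb; all-≤ to ≤b)
    interval : IsInterval π a b
    interval = value-closed-block⇒interval (≤-trans (a≤ i Si) (≤b i Si))
      λ (ai , ib) (aj , jb) i<y y<j →
        let Sy = closed (contiguous Sa Sb ai ib) (contiguous Sa Sb aj jb) i<y y<j in a≤ _ Sy , ≤b _ Sy
    at-a : a ≡ b → ∀ {y} → S y → P y ≡ P a
    at-a a≡b {y} Sy = ≤-antisym (≤-trans (≤b y Sy) (≤-reflexive (cong P (sym a≡b)))) (a≤ y Sy)
    trivial⇒i≡j : TrivialInterval a b → i ≡ j
    trivial⇒i≡j (inj₁ a≡b) = P-injective (trans (at-a a≡b Si) (sym (at-a a≡b Sj)))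
    trivial⇒i≡j (inj₂ (a-first , b-last)) =
      ⊥-elim (¬Sw (contiguous Sa Sb (subst (λ m → suc m ≤ P w) (sym a-first) (s≤s z≤n))
                                    (subst (P w ≤_) (sym b-last) (P≤n w))))

module Configuration {n} (π : Permutation′ n) (simple : Simple π)
  (avoid2143 : Avoids pat2143 π) (avoid4231 : Avoids pat4231 π)
  (l r u d : Fin n) (l-first : P l ≡ 1) (r-last : P r ≡ n) (u-top : V π u ≡ n) (d-bottom : V π d ≡ 1)
  (1<Pd : 1 < P d) (Pd<Pu : P d < P u) (Pu<n : P u < n)
  (1<Vr : 1 < V π r) (Vr<Vl : V π r < V π l) (Vl<n : V π l < n) where

  v : Fin n → ℕ
  v = V π

  A B D F G Bu Fd : Fin n → Set
  A = InBox π 1 (P d) (v l) n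
  B = InBox π (P d) (P u) (v l) n
  D = InBox π (P d) (P u) (v r) (v l)
  F = InBox π (P d) (P u) 1 (v r)
  G = InBox π (P u) n 1 (v r)
  Bu = λ i → B i ⊎ i ≡ u
  Fd = λ i → F i ⊎ i ≡ d

  1<P : ∀ {y} → y ≢ l → 1 < P y
  1<P {y} y≢l = ≤∧≢⇒< (s≤s z≤n) λ 1≡Py → y≢l (P-injective (trans (sym 1≡Py) (sym l-first)))

  P<n : ∀ {y} → y ≢ r → P y < n
  P<n {y} y≢r = ≤∧≢⇒< (P≤n y) λ Py≡n → y≢r (P-injective (trans Py≡n (sym r-last)))

  1<V : ∀ {y} → y ≢ d → 1 < v y
  1<V {y} y≢d = ≤∧≢⇒< (s≤s z≤n) λ 1≡Vy → y≢d (V-injective π (trans (sym 1≡Vy) (sym d-bottom)))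

  V<n : ∀ {y} → y ≢ u → v y < n
  V<n {y} y≢u = ≤∧≢⇒< (V≤n π y) λ Vy≡n → y≢u (V-injective π (trans Vy≡n (sym u-top)))

  Pl<P : ∀ {y} → y ≢ l → P l < P y
  Pl<P {y} y≢l = subst (_< P y) (sym l-first) (1<P y≢l)

  P<Pr : ∀ {y} → y ≢ r → P y < P r
  P<Pr {y} y≢r = subst (P y <_) (sym r-last) (P<n y≢r)

  Vd<V : ∀ {y} → y ≢ d → v d < v y
  Vd<V {y} y≢d = subst (_< v y) (sym d-bottom) (1<V y≢d)

  V<Vu : ∀ {y} → y ≢ u → v y < v u
  V<Vu {y} y≢u = subst (v y <_) (sym u-top) (V<n y≢u)

  Pl<Pd : P l < P d
  Pl<Pd = subst (_< P d) (sym l-first) 1<Pd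

  Pu<Pr : P u < P r
  Pu<Pr = subst (P u <_) (sym r-last) Pu<n

  Pd<Pr : P d < P r
  Pd<Pr = <-trans Pd<Pu Pu<Pr

  Vd<Vr : v d < v r
  Vd<Vr = subst (_< v r) (sym d-bottom) 1<Vr

  Vd<Vl : v d < v l
  Vd<Vl = <-trans Vd<Vr Vr<Vl

  Vl<Vu : v l < v u
  Vl<Vu = subst (v l <_) (sym u-top) Vl<n

  Vr<Vu : v r < v u
  Vr<Vu = <-trans Vr<Vl Vl<Vu

  data Column (y : Fin n) : Set where
    left   : P y < P d → Column y
    on-d   : y ≡ d → Column y
    centre : P d < P y → P y < P u → Column y
    on-u   : y ≡ u → Column y
    right  : P u < P y → Column y

  column : ∀ y → Column y
  column y with <-cmp (P y) (P d)
  ... | tri< y<d _ _ = left y<d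
  ... | tri≈ _ y≡d _ = on-d (P-injective y≡d)
  ... | tri> _ _ d<y with <-cmp (P y) (P u)
  ...   | tri< y<u _ _ = centre d<y y<u
  ...   | tri≈ _ y≡u _ = on-u (P-injective y≡u)
  ...   | tri> _ _ u<y = right u<y

  no-low-left : ∀ {y} → P y < P d → v y < v r → ⊥
  no-low-left {y} y<d y<r =
    no2143 π avoid2143 y d u r y<d Pd<Pu Pu<Pr (Vd<V (P<⇒≢ y<d)) y<r Vr<Vu

  no-high-right : ∀ {y} → P u < P y → v l < v y → ⊥
  no-high-right {y} u<y l<y =
    no2143 π avoid2143 l d u y Pl<Pd Pd<Pu u<y Vd<Vl l<y (V<Vu (≢-sym (P<⇒≢ u<y)))

  left-above-r : ∀ {y} → P y < P d → v r < v y
  left-above-r {y} y<d = V≤∧≢⇒< π (≮⇒≥ (no-low-left y<d)) (≢-sym (P<⇒≢ (<-trans y<d Pd<Pr)))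

  right-below-l : ∀ {y} → P u < P y → v y < v l
  right-below-l {y} u<y =
    V≤∧≢⇒< π (≮⇒≥ (no-high-right u<y)) (≢-sym (P<⇒≢ (<-trans Pl<Pd (<-trans Pd<Pu u<y))))

  prefix-not-closed : ∀ {z} → z ≢ l → P z < P r → ¬ ValueClosed π (λ y → P y ≤ P z)
  prefix-not-closed {z} z≢l z<r closed =
    z≢l (sym (simple⇒atMostOne π simple (λ y → P y ≤? P z) (λ _ b≤z _ y≤b → ≤-trans y≤b b≤z) closed
                r (<⇒≱ z<r) l z (<⇒≤ (Pl<P z≢l)) ≤-refl))

  suffix-not-closed : ∀ {z} → z ≢ r → P l < P z → ¬ ValueClosed π (λ y → P z ≤ P y)
  suffix-not-closed {z} z≢r l<z closed =
    z≢r (simple⇒atMostOne π simple (λ y → P z ≤? P y) (λ z≤a _ a≤y _ → ≤-trans z≤a a≤y) closed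
           l (<⇒≱ l<z) z r ≤-refl (<⇒≤ (P<Pr z≢r)))

  C-empty : ∀ {x} → P x < P d → v r < v x → v x < v l → ⊥
  C-empty {x} x<d r<x x<l = prefix-not-closed (V<⇒≢ π x<l) (<-trans x<d Pd<Pr) closed
    where
    closed : ValueClosed π (λ y → P y ≤ P x)
    closed {i} {j} {y} i≤x j≤x i<y y<j = ≮⇒≥ not-right
      where
      not-right : P x < P y → ⊥
      not-right x<Py with <-cmp (v x) (v y)
      ... | tri< x<y _ _ =
        no4231 π avoid4231 j x y r (P≤∧≢⇒< j≤x (≢-sym (V<⇒≢ π (<-trans x<y y<j))))
          x<Py (P<Pr (≢-sym (V<⇒≢ π (<-trans r<x x<y)))) r<x x<y y<j
      ... | tri≈ _ x≡y _ = P<⇒≢ x<Py (V-injective π x≡y)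
      ... | tri> _ _ y<x =
        no4231 π avoid4231 l i y r (Pl<P (V<⇒≢ π (<-trans i<y (<-trans y<x x<l)))) (≤-<-trans i≤x x<Py)
          (P<Pr (≢-sym (V<⇒≢ π (<-trans r<i i<y)))) r<i i<y (<-trans y<x x<l)
        where
        r<i : v r < v i
        r<i = left-above-r (≤-<-trans i≤x x<d)

  E-empty : ∀ {x} → P u < P x → v r < v x → v x < v l → ⊥
  E-empty {x} u<x r<x x<l =
    suffix-not-closed (≢-sym (V<⇒≢ π r<x)) (<-trans Pl<Pd (<-trans Pd<Pu u<x)) closed
    where
    closed : ValueClosed π (λ y → P x ≤ P y)
    closed {i} {j} {y} x≤i x≤j i<y y<j = ≮⇒≥ not-left
      where
      not-left : P y < P x → ⊥
      not-left Py<x with <-cmp (v y) (v x)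
      ... | tri< y<x _ _ =
        no4231 π avoid4231 l y x i (Pl<P (V<⇒≢ π (<-trans y<x x<l))) Py<x
          (P≤∧≢⇒< x≤i (≢-sym (V<⇒≢ π (<-trans i<y y<x)))) i<y y<x x<l
      ... | tri≈ _ y≡x _ = P<⇒≢ Py<x (V-injective π y≡x)
      ... | tri> _ _ x<y =
        no4231 π avoid4231 l y j r (Pl<P (V<⇒≢ π (<-trans y<j j<l))) (<-≤-trans Py<x x≤j)
          (P<Pr (≢-sym (V<⇒≢ π (<-trans r<x (<-trans x<y y<j))))) (<-trans r<x x<y) y<j j<l
        where
        j<l : v j < v l
        j<l = right-below-l (<-≤-trans u<x x≤j)

  left-above-l : ∀ {y} → P y < P d → v l ≤ v y
  left-above-l y<d = ≮⇒≥ (C-empty y<d (left-above-r y<d))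

  right-below-r : ∀ {y} → P u < P y → v y ≤ v r
  right-below-r u<y = ≮⇒≥ λ r<y → E-empty u<y r<y (right-below-l u<y)

  left-strip⇒A : ∀ {y} → y ≢ l → P y < P d → A y
  left-strip⇒A y≢l y<d =
    1<P y≢l , y<d , V≤∧≢⇒< π (left-above-l y<d) (≢-sym y≢l) , V<n (P<⇒≢ (<-trans y<d Pd<Pu))

  right-strip⇒G : ∀ {y} → y ≢ r → P u < P y → G y
  right-strip⇒G y≢r u<y =
    u<y , P<n y≢r , 1<V (≢-sym (P<⇒≢ (<-trans Pd<Pu u<y))) , V≤∧≢⇒< π (right-below-r u<y) y≢r

  partition : ∀ i → i ≢ l → i ≢ r → i ≢ u → i ≢ d → A i ⊎ B i ⊎ D i ⊎ F i ⊎ G i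
  partition i i≢l i≢r i≢u i≢d with column i
  ... | left i<d  = inj₁ (left-strip⇒A i≢l i<d)
  ... | on-d i≡d  = ⊥-elim (i≢d i≡d)
  ... | on-u i≡u  = ⊥-elim (i≢u i≡u)
  ... | right u<i = inj₂ (inj₂ (inj₂ (inj₂ (right-strip⇒G i≢r u<i))))
  ... | centre d<i i<u with <-cmp (v i) (v r)
  ...   | tri< i<r _ _ = inj₂ (inj₂ (inj₂ (inj₁ (d<i , i<u , 1<V i≢d , i<r))))
  ...   | tri≈ _ i≡r _ = ⊥-elim (i≢r (V-injective π i≡r))
  ...   | tri> _ _ r<i with <-cmp (v i) (v l)
  ...     | tri< i<l _ _ = inj₂ (inj₂ (inj₁ (d<i , i<u , r<i , i<l)))
  ...     | tri≈ _ i≡l _ = ⊥-elim (i≢l (V-injective π i≡l))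
  ...     | tri> _ _ l<i = inj₂ (inj₁ (d<i , i<u , l<i , V<n i≢u))

  Bu-increasing : Increasing π Bu
  Bu-increasing i j (inj₁ (d<i , _ , _ , _)) (inj₁ (_ , _ , l<j , _)) i<j =
    rising π i<j λ j<i → no2143 π avoid2143 l d i j Pl<Pd d<i i<j Vd<Vl l<j j<i
  Bu-increasing i _ (inj₁ (_ , _ , _ , i<n)) (inj₂ refl) _ = subst (v i <_) (sym u-top) i<n
  Bu-increasing _ j (inj₂ refl) (inj₁ (_ , j<u , _ , _)) u<j = ⊥-elim (<-asym u<j j<u)
  Bu-increasing _ _ (inj₂ refl) (inj₂ refl) u<u = ⊥-elim (<-irrefl refl u<u)

  D-decreasing : Decreasing π D
  D-decreasing i j (d<i , _ , r<i , _) (_ , j<u , _ , j<l) i<j =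
    falling π i<j λ i<j′ →
      no4231 π avoid4231 l i j r (<-trans Pl<Pd d<i) i<j (<-trans j<u Pu<Pr) r<i i<j′ j<l

  Fd-increasing : Increasing π Fd
  Fd-increasing i j (inj₁ (_ , _ , _ , i<r)) (inj₁ (_ , j<u , _ , _)) i<j =
    rising π i<j λ j<i → no2143 π avoid2143 i j u r i<j j<u Pu<Pr j<i i<r Vr<Vu
  Fd-increasing _ j (inj₂ refl) (inj₁ (_ , _ , 1<j , _)) _ = subst (_< v j) (sym d-bottom) 1<j
  Fd-increasing i _ (inj₁ (d<i , _ , _ , _)) (inj₂ refl) i<d = ⊥-elim (<-asym i<d d<i)
  Fd-increasing _ _ (inj₂ refl) (inj₂ refl) d<d = ⊥-elim (<-irrefl refl d<d)

  above-l⇒left-or-Bu : ∀ {y} → v l < v y → P y < P d ⊎ Bu y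
  above-l⇒left-or-Bu {y} l<y with column y
  ... | left y<d       = inj₁ y<d
  ... | on-d refl      = ⊥-elim (<-asym l<y Vd<Vl)
  ... | centre d<y y<u = inj₂ (inj₁ (d<y , y<u , l<y , V<n (P<⇒≢ y<u)))
  ... | on-u refl      = inj₂ (inj₂ refl)
  ... | right u<y      = ⊥-elim (no-high-right u<y l<y)

  Bu⇒Pd<P : ∀ {y} → Bu y → P d < P y
  Bu⇒Pd<P (inj₁ (d<y , _)) = d<y
  Bu⇒Pd<P (inj₂ refl) = Pd<Pu

  Bu⇒P<Pr : ∀ {y} → Bu y → P y < P r
  Bu⇒P<Pr (inj₁ (_ , y<u , _)) = <-trans y<u Pu<Pr
  Bu⇒P<Pr (inj₂ refl) = Pu<Pr

  Bu⇒Vl<V : ∀ {y} → Bu y → v l < v y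
  Bu⇒Vl<V (inj₁ (_ , _ , l<y , _)) = l<y
  Bu⇒Vl<V (inj₂ refl) = Vl<Vu

  Bu? : Decidable Bu
  Bu? i = ((P d <? P i) ×-dec (P i <? P u) ×-dec (v l <? v i) ×-dec (v i <? n)) ⊎-dec (i Finₚ.≟ u)

  open Least (least Bu? v (inj₂ refl)) renaming (point to s₁; holds to Bu-s₁; ≤-all to s₁≤)

  s₁-below-A : ∀ {x} → A x → v s₁ < v x
  s₁-below-A {x} (1<x , x<d , _ , _) =
    V≤∧≢⇒< π (≮⇒≥ not-below) (≢-sym (P<⇒≢ (<-trans x<d (Bu⇒Pd<P Bu-s₁))))
    where
    not-below : v x < v s₁ → ⊥
    not-below x<s₁ = prefix-not-closed z≢l (<-trans z<d Pd<Pr) closed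
      where
      Low : Fin n → Set
      Low y = P y < P d × v y < v s₁
      Low? : Decidable Low
      Low? y = (P y <? P d) ×-dec (v y <? v s₁)
      open Greatest (greatest Low? P P≤n (x<d , x<s₁)) renaming (point to z; holds to Low-z; all-≤ to ≤z)
      z<d : P z < P d
      z<d = proj₁ Low-z
      z<s₁ : v z < v s₁
      z<s₁ = proj₂ Low-z
      z≢l : z ≢ l
      z≢l = ≢-sym (P<⇒≢ (<-≤-trans (subst (_< P x) (sym l-first) 1<x) (≤z x (x<d , x<s₁))))
      upto-z-below-s₁ : ∀ {y} → P y ≤ P z → v y < v s₁
      upto-z-below-s₁ {y} y≤z =
        V≤∧≢⇒< π (≮⇒≥ s₁<y-impossible) (P<⇒≢ (≤-<-trans y≤z (<-trans z<d (Bu⇒Pd<P Bu-s₁))))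
        where
        s₁<y-impossible : v s₁ < v y → ⊥
        s₁<y-impossible s₁<y =
          no4231 π avoid4231 y z s₁ r (P≤∧≢⇒< y≤z (≢-sym (V<⇒≢ π (<-trans z<s₁ s₁<y))))
            (<-trans z<d (Bu⇒Pd<P Bu-s₁)) (Bu⇒P<Pr Bu-s₁) (left-above-r z<d) z<s₁ s₁<y
      closed : ValueClosed π (λ y → P y ≤ P z)
      closed {i} {j} {y} i≤z j≤z i<y y<j
        with above-l⇒left-or-Bu (≤-<-trans (left-above-l (≤-<-trans i≤z z<d)) i<y)
      ... | inj₁ y<d = ≤z y (y<d , <-trans y<j (upto-z-below-s₁ j≤z))
      ... | inj₂ Bu-y = ⊥-elim (<⇒≱ (<-trans y<j (upto-z-below-s₁ j≤z)) (s₁≤ y Bu-y))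

  s₁≢u : ∀ {x} → A x → s₁ ≢ u
  s₁≢u Ax@(_ , x<d , _) = V<⇒≢ π (<-trans (s₁-below-A Ax) (V<Vu (P<⇒≢ (<-trans x<d Pd<Pu))))

  module SecondSmallest (s₁≢u : s₁ ≢ u) where

    open Least (least (λ y → Bu? y ×-dec ¬? (y Finₚ.≟ s₁)) v (inj₂ refl , ≢-sym s₁≢u)) public
      renaming (point to s₂; holds to Bu∖s₁-s₂; ≤-all to s₂≤)

    Bu-s₂ : Bu s₂
    Bu-s₂ = proj₁ Bu∖s₁-s₂

    smallest-two : SmallestTwo π Bu s₁ s₂
    smallest-two = Bu-s₁ , Bu-s₂ , ≢-sym (proj₂ Bu∖s₁-s₂) , s₁≤ , λ c Bu-c c≢s₁ → s₂≤ c (Bu-c , c≢s₁)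

    Vs₁<Vs₂ : v s₁ < v s₂
    Vs₁<Vs₂ = V≤∧≢⇒< π (s₁≤ s₂ Bu-s₂) (≢-sym (proj₂ Bu∖s₁-s₂))

    A-below-s₂ : ∀ {x} → A x → v x < v s₂
    A-below-s₂ {x} (_ , x<d , _) = rising π (<-trans x<d (Bu⇒Pd<P Bu-s₂)) λ s₂<x →
      no4231 π avoid4231 x s₁ s₂ r (<-trans x<d (Bu⇒Pd<P Bu-s₁))
        (increasing⇒P< π Bu-increasing Bu-s₁ Bu-s₂ Vs₁<Vs₂)
        (Bu⇒P<Pr Bu-s₂) (<-trans Vr<Vl (Bu⇒Vl<V Bu-s₁)) Vs₁<Vs₂ s₂<x

    A-closed : ValueClosed π A
    A-closed {i} {j} {y} Ai Aj i<y y<j =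
      [ left-strip⇒A (≢-sym (V<⇒≢ π l<y)) , Bu-impossible ] (above-l⇒left-or-Bu l<y)
      where
      s₁<y : v s₁ < v y
      s₁<y = <-trans (s₁-below-A Ai) i<y
      l<y : v l < v y
      l<y = <-trans (Bu⇒Vl<V Bu-s₁) s₁<y
      Bu-impossible : Bu y → A y
      Bu-impossible Bu-y =
        ⊥-elim (<⇒≱ (<-trans y<j (A-below-s₂ Aj)) (s₂≤ y (Bu-y , ≢-sym (V<⇒≢ π s₁<y))))

  A-atMostOne : AtMostOne A
  A-atMostOne i j Ai Aj =
    simple⇒atMostOne π simple A? A-contiguous (SecondSmallest.A-closed (s₁≢u Ai)) r r∉A i j Ai Aj
    where
    A? : Decidable A
    A? y = (1 <? P y) ×-dec (P y <? P d) ×-dec (v l <? v y) ×-dec (v y <? n)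
    A-contiguous : Contiguous A
    A-contiguous (1<a , _) (_ , b<d , _) a≤y y≤b =
      left-strip⇒A (λ { refl → <⇒≱ (<-≤-trans 1<a a≤y) (≤-reflexive l-first) }) (≤-<-trans y≤b b<d)
    r∉A : ¬ A r
    r∉A (_ , r<d , _) = <-asym r<d Pd<Pr

  A-between : ∀ x → A x → ∃₂ λ s₁ s₂ → SmallestTwo π Bu s₁ s₂ × v s₁ < v x × v x < v s₂
  A-between x Ax = s₁ , s₂ , smallest-two , s₁-below-A Ax , A-below-s₂ Ax
    where open SecondSmallest (s₁≢u Ax)

  below-r⇒right-or-Fd : ∀ {y} → v y < v r → P u < P y ⊎ Fd y
  below-r⇒right-or-Fd {y} y<r with column y
  ... | left y<d       = ⊥-elim (no-low-left y<d y<r)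
  ... | on-d refl      = inj₂ (inj₂ refl)
  ... | centre d<y y<u = inj₂ (inj₁ (d<y , y<u , 1<V (≢-sym (P<⇒≢ d<y)) , y<r))
  ... | on-u refl      = ⊥-elim (<-asym y<r Vr<Vu)
  ... | right u<y      = inj₁ u<y

  Fd⇒Pl<P : ∀ {y} → Fd y → P l < P y
  Fd⇒Pl<P (inj₁ (d<y , _)) = <-trans Pl<Pd d<y
  Fd⇒Pl<P (inj₂ refl) = Pl<Pd

  Fd⇒P<Pu : ∀ {y} → Fd y → P y < P u
  Fd⇒P<Pu (inj₁ (_ , y<u , _)) = y<u
  Fd⇒P<Pu (inj₂ refl) = Pd<Pu

  Fd⇒V<Vr : ∀ {y} → Fd y → v y < v r
  Fd⇒V<Vr (inj₁ (_ , _ , _ , y<r)) = y<r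
  Fd⇒V<Vr (inj₂ refl) = Vd<Vr

  Fd? : Decidable Fd
  Fd? i = ((P d <? P i) ×-dec (P i <? P u) ×-dec (1 <? v i) ×-dec (v i <? v r)) ⊎-dec (i Finₚ.≟ d)

  open Greatest (greatest Fd? v (V≤n π) (inj₂ refl)) renaming (point to t₁; holds to Fd-t₁; all-≤ to ≤t₁)

  t₁-above-G : ∀ {x} → G x → v x < v t₁
  t₁-above-G {x} (u<x , x<n , _ , _) =
    V≤∧≢⇒< π (≮⇒≥ not-above) (≢-sym (P<⇒≢ (<-trans (Fd⇒P<Pu Fd-t₁) u<x)))
    where
    not-above : v t₁ < v x → ⊥
    not-above t₁<x = suffix-not-closed z≢r (<-trans (Fd⇒Pl<P Fd-t₁) (<-trans (Fd⇒P<Pu Fd-t₁) u<z)) closed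
      where
      High : Fin n → Set
      High y = P u < P y × v t₁ < v y
      High? : Decidable High
      High? y = (P u <? P y) ×-dec (v t₁ <? v y)
      open Least (least High? P (u<x , t₁<x)) renaming (point to z; holds to High-z; ≤-all to z≤)
      u<z : P u < P z
      u<z = proj₁ High-z
      t₁<z : v t₁ < v z
      t₁<z = proj₂ High-z
      z≢r : z ≢ r
      z≢r = P<⇒≢ (≤-<-trans (z≤ x (u<x , t₁<x)) (subst (P x <_) (sym r-last) x<n))
      from-z-above-t₁ : ∀ {y} → P z ≤ P y → v t₁ < v y
      from-z-above-t₁ {y} z≤y =
        V≤∧≢⇒< π (≮⇒≥ y<t₁-impossible) (P<⇒≢ (<-trans (Fd⇒P<Pu Fd-t₁) (<-≤-trans u<z z≤y)))
        where
        y<t₁-impossible : v y < v t₁ → ⊥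
        y<t₁-impossible y<t₁ =
          no4231 π avoid4231 l t₁ z y (Fd⇒Pl<P Fd-t₁) (<-trans (Fd⇒P<Pu Fd-t₁) u<z)
            (P≤∧≢⇒< z≤y (≢-sym (V<⇒≢ π (<-trans y<t₁ t₁<z))))
            y<t₁ t₁<z (right-below-l u<z)
      closed : ValueClosed π (λ y → P z ≤ P y)
      closed {i} {j} {y} z≤i z≤j i<y y<j
        with below-r⇒right-or-Fd (<-≤-trans y<j (right-below-r (<-≤-trans u<z z≤j)))
      ... | inj₁ u<y = z≤ y (u<y , <-trans (from-z-above-t₁ z≤i) i<y)
      ... | inj₂ Fd-y = ⊥-elim (<⇒≱ (<-trans (from-z-above-t₁ z≤i) i<y) (≤t₁ y Fd-y))

  t₁≢d : ∀ {x} → G x → t₁ ≢ d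
  t₁≢d Gx@(u<x , _) = ≢-sym (V<⇒≢ π (<-trans (Vd<V (≢-sym (P<⇒≢ (<-trans Pd<Pu u<x)))) (t₁-above-G Gx)))

  module SecondLargest (t₁≢d : t₁ ≢ d) where

    open Greatest (greatest (λ y → Fd? y ×-dec ¬? (y Finₚ.≟ t₁)) v (V≤n π) (inj₂ refl , ≢-sym t₁≢d)) public
      renaming (point to t₂; holds to Fd∖t₁-t₂; all-≤ to ≤t₂)

    Fd-t₂ : Fd t₂
    Fd-t₂ = proj₁ Fd∖t₁-t₂

    largest-two : LargestTwo π Fd t₁ t₂
    largest-two = Fd-t₁ , Fd-t₂ , ≢-sym (proj₂ Fd∖t₁-t₂) , ≤t₁ , λ c Fd-c c≢t₁ → ≤t₂ c (Fd-c , c≢t₁)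

    Vt₂<Vt₁ : v t₂ < v t₁
    Vt₂<Vt₁ = V≤∧≢⇒< π (≤t₁ t₂ Fd-t₂) (proj₂ Fd∖t₁-t₂)

    G-above-t₂ : ∀ {x} → G x → v t₂ < v x
    G-above-t₂ {x} (u<x , _) = rising π (<-trans (Fd⇒P<Pu Fd-t₂) u<x) λ x<t₂ →
      no4231 π avoid4231 l t₂ t₁ x (Fd⇒Pl<P Fd-t₂) (increasing⇒P< π Fd-increasing Fd-t₂ Fd-t₁ Vt₂<Vt₁)
        (<-trans (Fd⇒P<Pu Fd-t₁) u<x) x<t₂ Vt₂<Vt₁ (<-trans (Fd⇒V<Vr Fd-t₁) Vr<Vl)

    G-closed : ValueClosed π G
    G-closed {i} {j} {y} Gi Gj i<y y<j =
      [ right-strip⇒G (V<⇒≢ π y<r) , Fd-impossible ] (below-r⇒right-or-Fd y<r)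
      where
      y<t₁ : v y < v t₁
      y<t₁ = <-trans y<j (t₁-above-G Gj)
      y<r : v y < v r
      y<r = <-trans y<t₁ (Fd⇒V<Vr Fd-t₁)
      Fd-impossible : Fd y → G y
      Fd-impossible Fd-y = ⊥-elim (<⇒≱ (<-trans (G-above-t₂ Gi) i<y) (≤t₂ y (Fd-y , V<⇒≢ π y<t₁)))

  G-atMostOne : AtMostOne G
  G-atMostOne i j Gi Gj =
    simple⇒atMostOne π simple G? G-contiguous (SecondLargest.G-closed (t₁≢d Gi)) l l∉G i j Gi Gj
    where
    G? : Decidable G
    G? y = (P u <? P y) ×-dec (P y <? n) ×-dec (1 <? v y) ×-dec (v y <? v r)
    G-contiguous : Contiguous G
    G-contiguous (u<a , _) (_ , b<n , _) a≤y y≤b =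
      right-strip⇒G (λ { refl → <⇒≱ (≤-<-trans y≤b b<n) (≤-reflexive (sym r-last)) }) (<-≤-trans u<a a≤y)
    l∉G : ¬ G l
    l∉G (u<l , _) = <-asym u<l (<-trans Pl<Pd Pd<Pu)

  G-between : ∀ x → G x → ∃₂ λ s₁ s₂ → LargestTwo π Fd s₁ s₂ × v s₂ < v x × v x < v s₁
  G-between x Gx = t₁ , t₂ , largest-two , G-above-t₂ Gx , t₁-above-G Gx
    where open SecondLargest (t₁≢d Gx)

lemma3 : (n : ℕ) → 4 ≤ n → (π : Permutation′ n) → Simple π →
  Avoids pat2143 π → Avoids pat4231 π →
  (l r u d : Fin n) → P l ≡ 1 → P r ≡ n → V π u ≡ n → V π d ≡ 1 →
  1 < P d → P d < P u → P u < n →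
  1 < V π r → V π r < V π l → V π l < n →
  let A = InBox π 1 (P d) (V π l) n
      B = InBox π (P d) (P u) (V π l) n
      D = InBox π (P d) (P u) (V π r) (V π l)
      F = InBox π (P d) (P u) 1 (V π r)
      G = InBox π (P u) n 1 (V π r)
      Bu = λ i → B i ⊎ i ≡ u
      Fd = λ i → F i ⊎ i ≡ d
  in (∀ i → ¬ (i ≡ l) → ¬ (i ≡ r) → ¬ (i ≡ u) → ¬ (i ≡ d) →
        A i ⊎ B i ⊎ D i ⊎ F i ⊎ G i) ×
     Increasing π Bu ×
     Decreasing π D ×
     Increasing π Fd ×
     AtMostOne A ×
     (∀ x → A x → ∃₂ λ s₁ s₂ → SmallestTwo π Bu s₁ s₂ ×
        (V π s₁ < V π x) × (V π x < V π s₂)) ×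
     AtMostOne G ×
     (∀ x → G x → ∃₂ λ s₁ s₂ → LargestTwo π Fd s₁ s₂ ×
        (V π s₂ < V π x) × (V π x < V π s₁))
lemma3 _ _ π simple avoid2143 avoid4231 l r u d l-first r-last u-top d-bottom
       1<Pd Pd<Pu Pu<n 1<Vr Vr<Vl Vl<n =
  partition , Bu-increasing , D-decreasing , Fd-increasing ,
  A-atMostOne , A-between , G-atMostOne , G-between
  where
  open Configuration π simple avoid2143 avoid4231 l r u d l-first r-last u-top d-bottom
                     1<Pd Pd<Pu Pu<n 1<Vr Vr<Vl Vl<n
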